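{- For any $k,\Delta \in \mathbb{N}$, there exists an $L\in\mathbb{N}$ such that the following holds. If $G$ is a finite graph with $f(G) < k$ and maximum degree at most $\Delta$, then $G$ contains at most $L$ vertices of degree at least $k-1$.
   Context: All graphs are finite and simple. For a graph $G$, $f(G)$ denotes the largest integer $k$ for which $G$ contains an induced subgraph with $k$ distinct degrees (i.e., whose vertex degrees take exactly $k$ distinct values). -}

module Defs where

open import Data.Nat using (ℕ; zero; suc; _⊔_)
open import Data.Bool using (Bool; true; false; _∧_; if_then_else_)
open import Data.Fin using (Fin)
open import Data.Fin.Subset using (Subset; _∈_)
open import Data.Vec using (Vec; []; _∷_; lookup)
open import Data.List using (List; []; _∷_; map; _++_; foldr; filterᵇ; length; allFin; upTo)
open import Data.Bool.ListAction using (any)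
open import Relation.Binary.PropositionalEquality using (_≡_)
open import Relation.Nullary using (¬_)
open import Data.Nat using (_≡ᵇ_)

record Graph (n : ℕ) : Set where
  field
    adj   : Fin n → Fin n → Bool
    sym   : ∀ u v → adj u v ≡ adj v u
    irrefl : ∀ v → adj v v ≡ false
open Graph public

degIn : ∀ {n} → Graph n → Subset n → Fin n → ℕ
degIn {n} G S v = length (filterᵇ (λ u → lookup S u ∧ adj G v u) (allFin n))

deg : ∀ {n} → Graph n → Fin n → ℕ
deg {n} G v = length (filterᵇ (λ u → adj G v u) (allFin n))

-- number of distinct degree values among the vertices of the induced
-- subgraph G[S] (degrees lie in 0..n-1, so counting values d < n suffices
-- but we count d ≤ n for safety)
numDistinctDegrees : ∀ {n} → Graph n → Subset n → ℕ
numDistinctDegrees {n} G S =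
  length (filterᵇ (λ d → any (λ v → lookup S v ∧ (degIn G S v ≡ᵇ d)) (allFin n)) (upTo (suc n)))

allSubsets : (n : ℕ) → List (Subset n)
allSubsets zero = [] ∷ []
allSubsets (suc n) = map (true ∷_) (allSubsets n) ++ map (false ∷_) (allSubsets n)

maximum : List ℕ → ℕ
maximum = foldr _⊔_ 0

f : ∀ {n} → Graph n → ℕ
f {n} G = maximum (map (numDistinctDegrees G) (allSubsets n))

countDegAtLeast : ∀ {n} → Graph n → ℕ → ℕ
countDegAtLeast {n} G m = length (filterᵇ (λ v → m Data.Nat.≤ᵇ deg G v) (allFin n))

-- If some graph of maximum degree at most Δ has many vertices of degree at least k − 1,
-- then, as every vertex has at most Δ + Δ² vertices at distance 1 or 2, we can greedily
-- pick k of them, v₀ … v_{k−1}, pairwise at distance at least 3.  Let S consist of each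
-- vᵢ together with i of its neighbours.  Distance 3 keeps these stars from seeing each
-- other, so vᵢ has degree exactly i in G[S] and G[S] has k distinct degrees.  Hence
-- f G < k forces fewer than k (1 + Δ + Δ²) vertices of degree at least k − 1.

module Submission where

open import Defs renaming (sym to adj-sym; irrefl to adj-irrefl)
open import Data.Nat using (ℕ; _<_; _≤_; _∸_)
open import Data.Fin using (Fin)
open import Data.Product using (∃-syntax)

open import Data.Bool using (Bool; true; false; _∧_; _∨_; not; T; if_then_else_)
open import Data.Bool.Properties
  using (∧-comm; ∧-zeroʳ; ∧-identityʳ; ∨-identityʳ; T-≡; T-not-≡; T-∨; T-∧)
open import Data.Bool.ListAction using (any; or)
open import Data.Fin as Fin using (zero; suc; toℕ; _≟_)
open import Data.Fin.Properties using (toℕ-fromℕ<)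
open import Data.Fin.Subset using (Subset)
open import Data.List using (List; []; _∷_; length; filterᵇ; applyUpTo; allFin; tabulate; map)
import Data.List as List
open import Data.List.Properties
  using (map-cong; map-tabulate; tabulate-lookup; filter-≐; filter-none; length-filter; length-tabulate)
open import Data.List.Membership.Propositional using (_∈_; lose)
open import Data.List.Membership.Propositional.Properties
  using (∈-allFin; ∈-tabulate⁺; ∈-lookup; ∈-map⁺; ∈-++⁺ˡ; ∈-++⁺ʳ)
open import Data.List.Relation.Binary.Sublist.Propositional using (_⊆_; _∷_; ⊆-trans)
open import Data.List.Relation.Binary.Sublist.Propositional.Properties
  using (filter-⊆; filter⁺; length-mono-≤; ∷ˡ⁻; All-resp-⊆; []⊆-universal)
open import Data.List.Relation.Unary.All as All using (All; []; _∷_)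
open import Data.List.Relation.Unary.All.Properties using (all-filter)
open import Data.List.Relation.Unary.AllPairs using (AllPairs; []; _∷_)
import Data.List.Relation.Unary.AllPairs.Properties as AllPairs
open import Data.List.Relation.Unary.Any using (here; there)
open import Data.List.Relation.Unary.Any.Properties using (any⁺)
open import Data.Nat using (zero; suc; _+_; _*_; _<ᵇ_; _≤ᵇ_; _≡ᵇ_; z≤n; s≤s; s≤s⁻¹)
open import Data.Nat.Properties
  using ( ≤-refl; ≤-reflexive; ≤-trans; module ≤-Reasoning; n≤1+n; <⇒≤; <⇒≱; ≮⇒≥; <⇒≤pred
        ; +-suc; +-comm; +-mono-≤; +-monoʳ-≤; +-cancelˡ-≤; *-monoˡ-≤; m≤m⊔n; m≤n⊔m
        ; ≡⇒≡ᵇ; ≤ᵇ⇒≤; pred[m∸n]≡m∸[1+n])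
open import Data.Product using (_×_; _,_; proj₁; proj₂)
open import Data.Sum using (inj₁; inj₂)
open import Data.Vec using (lookup; []; _∷_)
import Data.Vec as Vec
import Data.Vec.Properties as Vec
open import Function using (_∘_; id; Equivalence)
open import Relation.Binary.PropositionalEquality using (_≡_; _≗_; refl; cong; cong₂; trans; sym; subst)
open import Relation.Nullary using (¬_; yes; no; contradiction)
open import Relation.Nullary.Decidable using (T?; ⌊_⌋; fromWitness)

private
  variable
    A : Set

length-filterᵇ-∨ : ∀ (p q : A → Bool) xs →
  length (filterᵇ (λ x → p x ∨ q x) xs) ≤ length (filterᵇ p xs) + length (filterᵇ q xs)
length-filterᵇ-∨ p q [] = z≤n
length-filterᵇ-∨ p q (x ∷ xs) with p x | q x
... | true  | true  = s≤s (≤-trans (length-filterᵇ-∨ p q xs) (+-monoʳ-≤ _ (n≤1+n _)))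
... | true  | false = s≤s (length-filterᵇ-∨ p q xs)
... | false | true  = ≤-trans (s≤s (length-filterᵇ-∨ p q xs)) (≤-reflexive (sym (+-suc _ _)))
... | false | false = length-filterᵇ-∨ p q xs

length-filterᵇ-not : ∀ (p : A → Bool) xs →
  length (filterᵇ (not ∘ p) xs) + length (filterᵇ p xs) ≡ length xs
length-filterᵇ-not p [] = refl
length-filterᵇ-not p (x ∷ xs) with p x
... | true  = trans (+-suc _ _) (cong suc (length-filterᵇ-not p xs))
... | false = cong suc (length-filterᵇ-not p xs)

any-∧ : ∀ (p q : A → Bool) xs → any (λ x → p x ∧ q x) xs ≡ any q (filterᵇ p xs)
any-∧ p q [] = refl
any-∧ p q (x ∷ xs) with p x
... | true  = cong (q x ∨_) (any-∧ p q xs)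
... | false = any-∧ p q xs

≤-length-filterᵇ-applyUpTo : ∀ (p : ℕ → Bool) (h : ℕ → ℕ) {k m} → k ≤ m →
  (∀ d → d < k → T (p (h d))) → k ≤ length (filterᵇ p (applyUpTo h m))
≤-length-filterᵇ-applyUpTo p h {zero} _ _ = z≤n
≤-length-filterᵇ-applyUpTo p h {suc k} {suc m} k≤m hit with p (h 0) | hit 0 (s≤s z≤n)
... | true  | _  =
  s≤s (≤-length-filterᵇ-applyUpTo p (h ∘ suc) (s≤s⁻¹ k≤m) (λ d d<k → hit (suc d) (s≤s d<k)))
... | false | ()

module _ (near : A → A → Bool) {B : ℕ} {univ : List A}
         (sparse : ∀ v → length (filterᵇ (near v) univ) ≤ B) where

  ∃-far-sublist : ∀ j xs → xs ⊆ univ → j * suc B ≤ length xs →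
    ∃[ vs ] vs ⊆ xs × length vs ≡ j × AllPairs (λ v w → T (not (near v w))) vs
  ∃-far-sublist zero xs _ _ = [] , []⊆-universal xs , refl , []
  ∃-far-sublist (suc j) (v ∷ xs) v∷xs⊆univ enough
    with ∃-far-sublist j (filterᵇ (not ∘ near v) xs) (⊆-trans (filter-⊆ _ xs) xs⊆univ) enough′
    where
      xs⊆univ : xs ⊆ univ
      xs⊆univ = ∷ˡ⁻ v∷xs⊆univ
      far = length (filterᵇ (not ∘ near v) xs)
      close = length (filterᵇ (near v) xs)
      close≤B : close ≤ B
      close≤B = ≤-trans (length-mono-≤ (filter⁺ _ _ (λ { refl t → t }) xs⊆univ)) (sparse v)
      enough′ : j * suc B ≤ far
      enough′ = +-cancelˡ-≤ (suc B) _ _ (begin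
        suc B + j * suc B  ≤⟨ enough ⟩
        suc (length xs)    ≡⟨ cong suc (sym (length-filterᵇ-not (near v) xs)) ⟩
        suc (far + close)  ≤⟨ s≤s (+-monoʳ-≤ far close≤B) ⟩
        suc (far + B)      ≡⟨ cong suc (+-comm far B) ⟩
        suc B + far        ∎)
        where open ≤-Reasoning
  ... | vs , vs⊆ , refl , far = v ∷ vs , refl ∷ ⊆-trans vs⊆ (filter-⊆ _ xs) , refl ,
        All-resp-⊆ vs⊆ (all-filter _ xs) ∷ far

count : ∀ {n} → (Fin n → Bool) → ℕ
count {n} p = length (filterᵇ p (allFin n))

count-cong : ∀ {n} {p q : Fin n → Bool} → p ≗ q → count p ≡ count q
count-cong {n} {p} {q} p≗q =
  cong length (filter-≐ (T? ∘ p) (T? ∘ q) ((λ {u} → subst T (p≗q u)) , λ {u} → subst T (sym (p≗q u)))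
                       (allFin n))

count-false : ∀ n → count {n} (λ _ → false) ≡ 0
count-false n = cong length (filter-none (T? ∘ λ _ → false) (All.universal (λ _ ()) (allFin n)))

count≤n : ∀ {n} (p : Fin n → Bool) → count p ≤ n
count≤n {n} p = ≤-trans (length-filter (T? ∘ p) (allFin n)) (≤-reflexive (length-tabulate id))

count-∨ : ∀ {n} (p q : Fin n → Bool) → count (λ u → p u ∨ q u) ≤ count p + count q
count-∨ {n} p q = length-filterᵇ-∨ p q (allFin n)

count-any≤ : ∀ {n} {b} (r : A → Fin n → Bool) → (∀ x → count (r x) ≤ b) →
  ∀ xs → count (λ u → any (λ x → r x u) xs) ≤ length xs * b
count-any≤ {n = n} r r≤b [] = ≤-reflexive (count-false n)
count-any≤ r r≤b (x ∷ xs) =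
  ≤-trans (count-∨ (r x) _) (+-mono-≤ (r≤b x) (count-any≤ r r≤b xs))

length-filterᵇ-tabulate : ∀ {n} (p : A → Bool) (g : Fin n → A) →
  length (filterᵇ p (tabulate g)) ≡ count (p ∘ g)
length-filterᵇ-tabulate {n = zero} p g = refl
length-filterᵇ-tabulate {n = suc n} p g with p (g zero)
... | true  = cong suc tail
  where tail = trans (length-filterᵇ-tabulate p (g ∘ suc)) (sym (length-filterᵇ-tabulate (p ∘ g) suc))
... | false = trans (length-filterᵇ-tabulate p (g ∘ suc)) (sym (length-filterᵇ-tabulate (p ∘ g) suc))

count-suc : ∀ {n} (p : Fin (suc n) → Bool) → count p ≡ (if p zero then 1 else 0) + count (p ∘ suc)
count-suc p with p zero
... | true  = cong suc (length-filterᵇ-tabulate p suc)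
... | false = length-filterᵇ-tabulate p suc

cutoff : ∀ {n} → (Fin n → Bool) → ℕ → ℕ
cutoff {zero}  p i       = 0
cutoff {suc n} p zero    = 0
cutoff {suc n} p (suc i) = suc (cutoff (p ∘ suc) (if p zero then i else suc i))

count-cutoff : ∀ {n} (p : Fin n → Bool) i → i ≤ count p →
  count (λ u → (toℕ u <ᵇ cutoff p i) ∧ p u) ≡ i
count-cutoff {zero}  p zero    _ = refl
count-cutoff {suc n} p zero    _ = count-false (suc n)
count-cutoff {suc n} p (suc i) i≤
  rewrite count-suc (λ u → (toℕ u <ᵇ cutoff p (suc i)) ∧ p u)
  with p zero | ≤-trans i≤ (≤-reflexive (count-suc p))
... | true  | i<count = cong suc (count-cutoff (p ∘ suc) i (s≤s⁻¹ i<count))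
... | false | i≤count = count-cutoff (p ∘ suc) (suc i) i≤count

≤-maximum : ∀ {x xs} → x ∈ xs → x ≤ maximum xs
≤-maximum (here refl) = m≤m⊔n _ _
≤-maximum {xs = y ∷ _} (there x∈xs) = ≤-trans (≤-maximum x∈xs) (m≤n⊔m y _)

∈-allSubsets : ∀ {n} (S : Subset n) → S ∈ allSubsets n
∈-allSubsets {zero}  []          = here refl
∈-allSubsets {suc n} (true ∷ S)  = ∈-++⁺ˡ (∈-map⁺ (true ∷_) (∈-allSubsets S))
∈-allSubsets {suc n} (false ∷ S) =
  ∈-++⁺ʳ (map (true ∷_) (allSubsets n)) (∈-map⁺ (false ∷_) (∈-allSubsets S))

numDistinctDegrees≤f : ∀ {n} (G : Graph n) S → numDistinctDegrees G S ≤ f G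
numDistinctDegrees≤f G S = ≤-maximum (∈-map⁺ (numDistinctDegrees G) (∈-allSubsets S))

≤-numDistinctDegrees : ∀ {n k} (G : Graph n) S →
  (∀ d → d < k → ∃[ v ] lookup S v ≡ true × degIn G S v ≡ d) → k ≤ numDistinctDegrees G S
≤-numDistinctDegrees {k = zero}  G S realised = z≤n
≤-numDistinctDegrees {n} {suc k} G S realised =
  ≤-length-filterᵇ-applyUpTo _ id (s≤s (subst (_≤ n) degree≡k (count≤n _))) occurs
  where
    degree≡k = proj₂ (proj₂ (realised k ≤-refl))
    occurs : ∀ d → d < suc k → T (any (λ v → lookup S v ∧ (degIn G S v ≡ᵇ d)) (allFin n))
    occurs d d<k with realised d d<k
    ... | v , v∈S , degree≡d = any⁺ _ (lose (∈-allFin v)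
          (Equivalence.from T-∧ (Equivalence.from T-≡ v∈S , ≡⇒≡ᵇ _ _ degree≡d)))

module _ {n} (G : Graph n) where

  near : Fin n → Fin n → Bool
  near v w = adj G v w ∨ any (λ x → adj G v x ∧ adj G x w) (allFin n)

  Far : Fin n → Fin n → Set
  Far v w = T (not (near v w))

  near-sym : ∀ v w → near v w ≡ near w v
  near-sym v w = cong₂ _∨_ (adj-sym G v w) (cong or (map-cong common (allFin n)))
    where
      common : ∀ x → adj G v x ∧ adj G x w ≡ adj G w x ∧ adj G x v
      common x = trans (∧-comm (adj G v x) (adj G x w)) (cong₂ _∧_ (adj-sym G x w) (adj-sym G v x))

  Far-sym : ∀ {v w} → Far v w → Far w v
  Far-sym {v} {w} = subst (T ∘ not) (near-sym v w)

  Far⇒¬near : ∀ {v w} → Far v w → ¬ T (near v w)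
  Far⇒¬near far t = subst T (Equivalence.to T-not-≡ far) t

  count-near≤ : ∀ {Δ} → (∀ v → deg G v ≤ Δ) → ∀ v → count (near v) ≤ Δ + Δ * Δ
  count-near≤ {Δ} deg≤Δ v = begin
    count (near v)
      ≤⟨ count-∨ (adj G v) _ ⟩
    deg G v + count (λ u → any (λ x → adj G v x ∧ adj G x u) (allFin n))
      ≡⟨ cong (deg G v +_) (count-cong (λ u → any-∧ (adj G v) (λ x → adj G x u) (allFin n))) ⟩
    deg G v + count (λ u → any (λ x → adj G x u) (filterᵇ (adj G v) (allFin n)))
      ≤⟨ +-mono-≤ (deg≤Δ v) (count-any≤ (adj G) deg≤Δ (filterᵇ (adj G v) (allFin n))) ⟩
    Δ + deg G v * Δ
      ≤⟨ +-monoʳ-≤ Δ (*-monoˡ-≤ Δ (deg≤Δ v)) ⟩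
    Δ + Δ * Δ ∎
    where open ≤-Reasoning

  star : Fin n × ℕ → Fin n → Bool
  star (w , s) u = ⌊ w ≟ u ⌋ ∨ ((toℕ u <ᵇ s) ∧ adj G w u)

  stars : List (Fin n × ℕ) → Fin n → Bool
  stars cs u = any (λ c → star c u) cs

  star-miss : ∀ {v w u} s → Far v w → adj G v u ≡ true → star (w , s) u ≡ false
  star-miss {v} {w} {u} s far vu with w ≟ u | adj G w u in wu
  ... | yes refl | _     = contradiction adjacent (Far⇒¬near far)
    where adjacent = Equivalence.from T-∨ (inj₁ (Equivalence.from T-≡ vu))
  ... | no _     | false = ∧-zeroʳ _
  ... | no _     | true  = contradiction throughU (Far⇒¬near far)
    where
      throughU : T (near v w)
      throughU = Equivalence.from T-∨ (inj₂ (any⁺ _ (lose (∈-allFin u)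
        (Equivalence.from T-∧ (Equivalence.from T-≡ vu , Equivalence.from T-≡ (trans (adj-sym G u w) wu))))))

  stars-miss : ∀ {v u} {cs : List (Fin n × ℕ)} → All (Far v ∘ proj₁) cs → adj G v u ≡ true →
    stars cs u ≡ false
  stars-miss []           vu = refl
  stars-miss {cs = (w , s) ∷ _} (far ∷ fars) vu rewrite star-miss s far vu = stars-miss fars vu

  stars-on-neighbours : ∀ {v t u} {cs : List (Fin n × ℕ)} →
    AllPairs (λ c c′ → Far (proj₁ c) (proj₁ c′)) cs →
    (v , t) ∈ cs → adj G v u ≡ true → stars cs u ≡ (toℕ u <ᵇ t)
  stars-on-neighbours {v} {t} {u} (fars ∷ _) (here refl) vu with v ≟ u
  ... | yes refl = contradiction (trans (sym vu) (adj-irrefl G v)) λ ()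
  ... | no _ rewrite vu | stars-miss fars vu = trans (∨-identityʳ _) (∧-identityʳ _)
  stars-on-neighbours {cs = (w , s) ∷ _} (far ∷ pairs) (there c∈cs) vu
    rewrite star-miss s (Far-sym (All.lookup far c∈cs)) vu = stars-on-neighbours pairs c∈cs vu

  staircase : List (Fin n) → List (Fin n × ℕ)
  staircase vs = tabulate (λ i → List.lookup vs i , cutoff (adj G (List.lookup vs i)) (toℕ i))

  staircase-far : ∀ {vs} → AllPairs Far vs →
    AllPairs (λ c c′ → Far (proj₁ c) (proj₁ c′)) (staircase vs)
  staircase-far {vs} pairs =
    AllPairs.map⁻ (subst (AllPairs Far) (sym (trans (map-tabulate _ proj₁) (tabulate-lookup vs))) pairs)

  module _ {vs : List (Fin n)} (pairs : AllPairs Far vs) where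

    staircaseSubset : Subset n
    staircaseSubset = Vec.tabulate (stars (staircase vs))

    centre∈staircase : ∀ i → lookup staircaseSubset (List.lookup vs i) ≡ true
    centre∈staircase i = trans (Vec.lookup∘tabulate (stars (staircase vs)) v)
      (Equivalence.to T-≡ (any⁺ (λ c → star c v) (lose (∈-tabulate⁺ i) own-star)))
      where
        v = List.lookup vs i
        own-star : T (star (v , cutoff (adj G v) (toℕ i)) v)
        own-star = Equivalence.from T-∨ (inj₁ (fromWitness {a? = v ≟ v} refl))

    degIn-centre : ∀ i → toℕ i ≤ deg G (List.lookup vs i) →
      degIn G staircaseSubset (List.lookup vs i) ≡ toℕ i
    degIn-centre i i≤deg = trans (count-cong onNeighbours) (count-cutoff (adj G v) (toℕ i) i≤deg)
      where
        v = List.lookup vs i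
        onNeighbours : ∀ u →
          lookup staircaseSubset u ∧ adj G v u ≡ (toℕ u <ᵇ cutoff (adj G v) (toℕ i)) ∧ adj G v u
        onNeighbours u rewrite Vec.lookup∘tabulate (stars (staircase vs)) u with adj G v u in vu
        ... | true  = trans (∧-identityʳ _)
          (trans (stars-on-neighbours (staircase-far pairs) (∈-tabulate⁺ i) vu) (sym (∧-identityʳ _)))
        ... | false = trans (∧-zeroʳ _) (sym (∧-zeroʳ _))

    far-centres⇒≤f : ∀ {k} → length vs ≡ k → All (λ v → k ∸ 1 ≤ deg G v) vs → k ≤ f G
    far-centres⇒≤f {k} refl high =
      ≤-trans (≤-numDistinctDegrees G staircaseSubset realised) (numDistinctDegrees≤f G staircaseSubset)
      where
        realised : ∀ d → d < k →
          ∃[ v ] lookup staircaseSubset v ≡ true × degIn G staircaseSubset v ≡ d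
        realised d d<k = List.lookup vs i , centre∈staircase i , trans (degIn-centre i i≤deg) toℕi≡d
          where
            i = Fin.fromℕ< d<k
            toℕi≡d = toℕ-fromℕ< d<k
            d≤k∸1 : d ≤ k ∸ 1
            d≤k∸1 = subst (d ≤_) (pred[m∸n]≡m∸[1+n] k 0) (<⇒≤pred d<k)
            i≤deg : toℕ i ≤ deg G (List.lookup vs i)
            i≤deg = subst (_≤ deg G (List.lookup vs i)) (sym toℕi≡d)
              (≤-trans d≤k∸1 (All.lookup high (∈-lookup i)))

  many-high-degree⇒≤f : ∀ {k Δ} → (∀ v → deg G v ≤ Δ) →
    k * suc (Δ + Δ * Δ) ≤ countDegAtLeast G (k ∸ 1) → k ≤ f G
  many-high-degree⇒≤f {k} deg≤Δ many =
    let vs , vs⊆high , length≡k , pairs =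
          ∃-far-sublist near (count-near≤ deg≤Δ) k high (filter-⊆ _ (allFin n)) many
    in far-centres⇒≤f pairs length≡k
         (All.map (λ {v} → ≤ᵇ⇒≤ (k ∸ 1) (deg G v)) (All-resp-⊆ vs⊆high (all-filter _ (allFin n))))
    where
      high : List (Fin n)
      high = filterᵇ (λ v → k ∸ 1 ≤ᵇ deg G v) (allFin n)

proposition2p2 : ∀ (k Δ : ℕ) → ∃[ L ] ∀ (n : ℕ) (G : Graph n) →
    f G < k → (∀ (v : Fin n) → deg G v ≤ Δ) →
    countDegAtLeast G (k ∸ 1) ≤ L
proposition2p2 k Δ = k * suc (Δ + Δ * Δ) , λ n G f<k deg≤Δ →
  ≮⇒≥ λ L<count → <⇒≱ f<k (many-high-degree⇒≤f G deg≤Δ (<⇒≤ L<count))
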